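{- For every integer $n\geq 0$, \[ \sum_{k=0}^{n}(-1)^k x^k q^{k(3k+1)/2}{n\brack k}\frac{1-x q^{2k+1}}{(xq^{k+1};q)_{n+1}}=1. \]
   Context: For a complex number $a$ and a nonnegative integer $m$, $(a;q)_m=\prod_{j=0}^{m-1}(1-aq^j)$. The $q$-binomial coefficient is ${n\brack k}=\frac{(q;q)_n}{(q;q)_k(q;q)_{n-k}}$ for $0\le k\le n$. Here $q$ is a complex number with $|q|<1$ and $x$ is such that all denominators are nonzero (equivalently, the identity holds as an identity of rational functions). -}

module Defs where

open import Level using (Level; _⊔_) renaming (suc to lsuc)
open import Algebra.Bundles using (CommutativeRing)
open import Data.Nat using (ℕ; zero; suc; _∸_) renaming (_+_ to _+ℕ_; _*_ to _*ℕ_)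
open import Relation.Nullary using (¬_)

-- A field: a commutative ring with 0 ≠ 1 and a (total) inverse that is a
-- genuine inverse on nonzero elements (convention 0⁻¹ = 0, irrelevant below
-- since all denominators are assumed nonzero).
record Field (c ℓ : Level) : Set (lsuc (c ⊔ ℓ)) where
  field
    commutativeRing : CommutativeRing c ℓ
  open CommutativeRing commutativeRing public
  field
    _⁻¹       : Carrier → Carrier
    ⁻¹-cong   : ∀ {a b} → a ≈ b → a ⁻¹ ≈ b ⁻¹
    ⁻¹-inverse : ∀ a → ¬ (a ≈ 0#) → a * a ⁻¹ ≈ 1#
    ⁻¹-zero   : 0# ⁻¹ ≈ 0#
    0≉1       : ¬ (0# ≈ 1#)

module FieldOps {c ℓ : Level} (F : Field c ℓ) where
  open Field F public

  _÷_ : Carrier → Carrier → Carrier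
  a ÷ b = a * b ⁻¹

  pow : Carrier → ℕ → Carrier
  pow a zero    = 1#
  pow a (suc m) = a * pow a m

  poch : Carrier → Carrier → ℕ → Carrier
  poch a q zero    = 1#
  poch a q (suc m) = poch a q m * (1# - a * pow q m)

  qbinom : Carrier → ℕ → ℕ → Carrier
  qbinom q n k = poch q q n ÷ (poch q q k * poch q q (n ∸ k))

  sumTo : ℕ → (ℕ → Carrier) → Carrier
  sumTo zero    f = f 0
  sumTo (suc n) f = sumTo n f + f (suc n)

-- The summands F n k form a WZ pair with the certificate
--   G n k = − (−1)^k x^k q^(k(3k+1)/2) q^(n+1−k) [n, k−1] / (x q^(k+1); q)_(n+1)   ([n, −1] = 0),
-- that is F (n+1) k − F n k = G n (k+1) − G n k for k ≤ n, and F (n+1) (n+1) = − G n (n+1).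
-- Summing over k, the sum telescopes to the sum for n, and the sum for n = 0 is 1.
-- Over the common denominator (x q^(k+1); q)_(n+2) the WZ equation is a polynomial identity
-- modulo the q-Pascal rule [n+1, k] = [n, k] + q^(n+1−k) [n, k−1] and the ratio rule
-- [n, k] (1 − q^k) = [n, k−1] (1 − q^(n+1−k)).

module Submission where

open import Defs
open import Algebra.Bundles using (CommutativeRing; RawRing)
open import Algebra.Solver.Ring.AlmostCommutativeRing
  using (fromCommutativeRing; _-Raw-AlmostCommutative⟶_)
open import Data.Maybe using (Maybe; just; nothing)
open import Data.Nat using (ℕ; zero; suc; _∸_; _≤_; z≤n; s≤s) renaming (_+_ to _+ℕ_; _*_ to _*ℕ_)
open import Data.Nat.DivMod using (_/_; +-distrib-/-∣ʳ; m*n/n≡m)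
open import Data.Nat.Divisibility using (divides)
import Data.Nat.Properties as ℕ
open import Data.Nat.Properties
  using (+-suc; m+n∸m≡n; n∸n≡0; m≤n⇒∃[o]m+o≡n; ≤-refl; m≤n⇒m≤1+n; m≤m+n; m≤n+m; n≤1+n)
open import Data.Nat.Tactic.RingSolver using (solve-∀)
open import Data.Product using (_×_; _,_)
open import Data.Product.Properties using (≡-dec)
open import Level using (0ℓ)
open import Relation.Binary.PropositionalEquality as ≡ using (_≡_; cong)
open import Relation.Nullary using (¬_; yes; no)

-- The library's solvers for an arbitrary commutative ring use either the ring's own elements as
-- coefficients, whose equality is undecidable, or natural numbers; this instantiates
-- Algebra.Solver.Ring with integer coefficients.
module IntegerCoefficientSolver {c ℓ} (R : CommutativeRing c ℓ) where
  open import Data.Nat using (_+_; _*_; _≟_)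
  open CommutativeRing R
    renaming (_+_ to _⊕_; _*_ to _⊛_; refl to ≈-refl)
    using (Carrier; _≈_; 0#; 1#; -_; _-_; setoid; sym; trans; ring; semiring; +-commutativeSemigroup;
           +-cong; +-congˡ; +-congʳ; -‿cong; -‿inverseʳ; +-identityˡ; +-identityʳ; +-comm)
  open import Algebra.Properties.Ring ring
    using (⁻¹-anti-homo‿-; -‿+-comm; -0#≈0#; x[y-z]≈xy-xz; [y-z]x≈yx-zx)
  open import Algebra.Properties.CommutativeSemigroup +-commutativeSemigroup using (interchange)
  open import Algebra.Properties.Semiring.Mult semiring using (×-homo-+; ×1-homo-*) renaming (_×_ to _·_)
  open import Relation.Binary.Reasoning.Setoid setoid

  -- (a , b) stands for a − b; the representative (a ∸ b , b ∸ a) makes equal integers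
  -- equal pairs, which the solver needs in order to compare normal forms.
  reduce : ℕ × ℕ → ℕ × ℕ
  reduce (a , b) = a ∸ b , b ∸ a

  ℤ-rawRing : RawRing 0ℓ 0ℓ
  ℤ-rawRing = record
    { Carrier = ℕ × ℕ
    ; _≈_ = _≡_
    ; _+_ = λ { (a , b) (c , d) → reduce (a + c , b + d) }
    ; _*_ = λ { (a , b) (c , d) → reduce (a * c + b * d , a * d + b * c) }
    ; -_ = λ { (a , b) → b , a }
    ; 0# = 0 , 0
    ; 1# = 1 , 0
    }

  ⟦_⟧ℤ : ℕ × ℕ → Carrier
  ⟦ a , b ⟧ℤ = a · 1# - b · 1#

  [u-v]+[w-z]≈[u+w]-[v+z] : ∀ u v w z → (u - v) ⊕ (w - z) ≈ (u ⊕ w) - (v ⊕ z)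
  [u-v]+[w-z]≈[u+w]-[v+z] u v w z = trans (interchange u (- v) w (- z)) (+-congˡ (-‿+-comm v z))

  [u-v]-[w-z]≈[u+z]-[w+v] : ∀ u v w z → (u - v) - (w - z) ≈ (u ⊕ z) - (w ⊕ v)
  [u-v]-[w-z]≈[u+z]-[w+v] u v w z = begin
    (u - v) - (w - z)  ≈⟨ +-congˡ (⁻¹-anti-homo‿- w z) ⟩
    (u - v) ⊕ (z - w)  ≈⟨ [u-v]+[w-z]≈[u+w]-[v+z] u v z w ⟩
    (u ⊕ z) - (v ⊕ w)  ≈⟨ +-congˡ (-‿cong (+-comm v w)) ⟩
    (u ⊕ z) - (w ⊕ v)  ∎

  reduce-sound : ∀ p → ⟦ reduce p ⟧ℤ ≈ ⟦ p ⟧ℤ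
  reduce-sound (zero  , zero)  = ≈-refl
  reduce-sound (zero  , suc b) = ≈-refl
  reduce-sound (suc a , zero)  = ≈-refl
  reduce-sound (suc a , suc b) = begin
    ⟦ reduce (a , b) ⟧ℤ                  ≈⟨ reduce-sound (a , b) ⟩
    a · 1# - b · 1#                      ≈⟨ +-identityˡ _ ⟨
    0# ⊕ (a · 1# - b · 1#)               ≈⟨ +-congʳ (-‿inverseʳ 1#) ⟨
    (1# - 1#) ⊕ (a · 1# - b · 1#)        ≈⟨ [u-v]+[w-z]≈[u+w]-[v+z] 1# 1# _ _ ⟩
    (1# ⊕ a · 1#) - (1# ⊕ b · 1#)        ∎

  homomorphism : ℤ-rawRing -Raw-AlmostCommutative⟶ fromCommutativeRing R
  homomorphism = record
    { ⟦_⟧    = ⟦_⟧ℤ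
    ; +-homo = λ { (a , b) (c , d) → begin
        ⟦ reduce (a + c , b + d) ⟧ℤ                 ≈⟨ reduce-sound (a + c , b + d) ⟩
        (a + c) · 1# - (b + d) · 1#                ≈⟨ +-cong (×-homo-+ 1# a c) (-‿cong (×-homo-+ 1# b d)) ⟩
        (a · 1# ⊕ c · 1#) - (b · 1# ⊕ d · 1#)      ≈⟨ [u-v]+[w-z]≈[u+w]-[v+z] _ _ _ _ ⟨
        ⟦ a , b ⟧ℤ ⊕ ⟦ c , d ⟧ℤ                    ∎ }
    ; *-homo = λ { (a , b) (c , d) → let A = a · 1#; B = b · 1#; C = c · 1#; D = d · 1# in begin
        ⟦ reduce (a * c + b * d , a * d + b * c) ⟧ℤ  ≈⟨ reduce-sound (a * c + b * d , a * d + b * c) ⟩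
        (a * c + b * d) · 1# - (a * d + b * c) · 1#
          ≈⟨ +-cong (trans (×-homo-+ 1# (a * c) (b * d)) (+-cong (×1-homo-* a c) (×1-homo-* b d)))
                    (-‿cong (trans (×-homo-+ 1# (a * d) (b * c)) (+-cong (×1-homo-* a d) (×1-homo-* b c)))) ⟩
        (A ⊛ C ⊕ B ⊛ D) - (A ⊛ D ⊕ B ⊛ C)            ≈⟨ [u-v]-[w-z]≈[u+z]-[w+v] _ _ _ _ ⟨
        (A ⊛ C - B ⊛ C) - (A ⊛ D - B ⊛ D)            ≈⟨ +-cong ([y-z]x≈yx-zx C A B) (-‿cong ([y-z]x≈yx-zx D A B)) ⟨
        (A - B) ⊛ C - (A - B) ⊛ D                    ≈⟨ x[y-z]≈xy-xz (A - B) C D ⟨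
        ⟦ a , b ⟧ℤ ⊛ ⟦ c , d ⟧ℤ                      ∎ }
    ; -‿homo = λ { (a , b) → sym (⁻¹-anti-homo‿- (a · 1#) (b · 1#)) }
    ; 0-homo = -‿inverseʳ 0#
    ; 1-homo = trans (+-cong (+-identityʳ 1#) -0#≈0#) (+-identityʳ 1#)
    }

  coefficient≟ : ∀ p p′ → Maybe (⟦ p ⟧ℤ ≈ ⟦ p′ ⟧ℤ)
  coefficient≟ p p′ with ≡-dec _≟_ _≟_ p p′
  ... | yes ≡.refl = just ≈-refl
  ... | no _     = nothing

  open import Algebra.Solver.Ring ℤ-rawRing (fromCommutativeRing R) homomorphism coefficient≟ public
    using (Polynomial; con; solve; _:=_; _:+_; _:*_; _:-_; :-_; _:^_)

  -- Unlike con (1 , 0), this evaluates to 1# definitionally.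
  :1 : ∀ {n} → Polynomial n
  :1 = con (0 , 0) :^ 0

pentagonal : ℕ → ℕ
pentagonal k = (k *ℕ (3 *ℕ k +ℕ 1)) / 2

pentagonal-suc : ∀ k → pentagonal (suc k) ≡ pentagonal k +ℕ (3 *ℕ k +ℕ 2)
pentagonal-suc k = begin
  (suc k *ℕ (3 *ℕ suc k +ℕ 1)) / 2                  ≡⟨ cong (_/ 2) (expand k) ⟩
  (k *ℕ (3 *ℕ k +ℕ 1) +ℕ (3 *ℕ k +ℕ 2) *ℕ 2) / 2   ≡⟨ +-distrib-/-∣ʳ (k *ℕ (3 *ℕ k +ℕ 1)) (divides (3 *ℕ k +ℕ 2) ≡.refl) ⟩
  pentagonal k +ℕ (3 *ℕ k +ℕ 2) *ℕ 2 / 2           ≡⟨ cong (pentagonal k +ℕ_) (m*n/n≡m (3 *ℕ k +ℕ 2) 2) ⟩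
  pentagonal k +ℕ (3 *ℕ k +ℕ 2)                    ∎
  where
  open ≡.≡-Reasoning
  expand : ∀ k → suc k *ℕ (3 *ℕ suc k +ℕ 1) ≡ k *ℕ (3 *ℕ k +ℕ 1) +ℕ (3 *ℕ k +ℕ 2) *ℕ 2
  expand = solve-∀

2k+1≡1+[k+k] : ∀ k → 2 *ℕ k +ℕ 1 ≡ suc (k +ℕ k)
2k+1≡1+[k+k] = solve-∀

3k+2≡2+[k+[k+k]] : ∀ k → 3 *ℕ k +ℕ 2 ≡ suc (suc (k +ℕ (k +ℕ k)))
3k+2≡2+[k+[k+k]] = solve-∀

1+j+s∸j≡1+s : ∀ j s → suc (j +ℕ s) ∸ j ≡ suc s
1+j+s∸j≡1+s j s = ≡.trans (cong (_∸ j) (≡.sym (+-suc j s))) (m+n∸m≡n j (suc s))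

module _ {c ℓ} (F : Field c ℓ) where
  open FieldOps F
  open IntegerCoefficientSolver commutativeRing
  open import Relation.Binary.Reasoning.Setoid setoid
  open import Algebra.Properties.Ring ring using (-0#≈0#)
  open import Algebra.Properties.CommutativeSemigroup +-commutativeSemigroup
    using (xy∙z≈xz∙y; xy∙z≈x∙zy)
  open import Algebra.Properties.CommutativeSemigroup *-commutativeSemigroup
    using () renaming (xy∙z≈y∙xz to xy*z≈y*xz; xy∙z≈xz∙y to xy*z≈xz*y; xy∙z≈x∙zy to xy*z≈x*zy)

  NonzeroUpTo : (ℕ → Carrier) → ℕ → Set ℓ
  NonzeroUpTo f N = ∀ m → m ≤ N → f m ≉ 0#

  x*y≉0⇒x≉0 : ∀ {x y} → x * y ≉ 0# → x ≉ 0#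
  x*y≉0⇒x≉0 {x} {y} xy≉0 x≈0 = xy≉0 (trans (*-congʳ x≈0) (zeroˡ y))

  x≉0⇒y≉0⇒x*y≉0 : ∀ {x y} → x ≉ 0# → y ≉ 0# → x * y ≉ 0#
  x≉0⇒y≉0⇒x*y≉0 {x} {y} x≉0 y≉0 xy≈0 = y≉0 (begin
    y               ≈⟨ *-identityˡ y ⟨
    1# * y          ≈⟨ *-congʳ (⁻¹-inverse x x≉0) ⟨
    x * x ⁻¹ * y    ≈⟨ xy*z≈y*xz x (x ⁻¹) y ⟩
    x ⁻¹ * (x * y)  ≈⟨ *-congˡ xy≈0 ⟩
    x ⁻¹ * 0#       ≈⟨ zeroʳ _ ⟩
    0#              ∎)

  x*y≈z⇒x⁻¹≈y*z⁻¹ : ∀ {x y z} → x * y ≈ z → z ≉ 0# → x ⁻¹ ≈ y * z ⁻¹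
  x*y≈z⇒x⁻¹≈y*z⁻¹ {x} {y} {z} xy≈z z≉0 = begin
    x ⁻¹                      ≈⟨ *-identityʳ _ ⟨
    x ⁻¹ * 1#                 ≈⟨ *-congˡ (⁻¹-inverse z z≉0) ⟨
    x ⁻¹ * (z * z ⁻¹)         ≈⟨ *-congˡ (*-congʳ xy≈z) ⟨
    x ⁻¹ * (x * y * z ⁻¹)     ≈⟨ solve 4 (λ x⁻¹ x y z⁻¹ → x⁻¹ :* (x :* y :* z⁻¹) := x :* x⁻¹ :* (y :* z⁻¹)) refl (x ⁻¹) x y (z ⁻¹) ⟩
    x * x ⁻¹ * (y * z ⁻¹)     ≈⟨ *-congʳ (⁻¹-inverse x (x*y≉0⇒x≉0 (λ xy≈0 → z≉0 (trans (sym xy≈z) xy≈0)))) ⟩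
    1# * (y * z ⁻¹)           ≈⟨ *-identityˡ _ ⟩
    y * z ⁻¹                  ∎

  x≈y⇒x÷y≈1 : ∀ {x y} → x ≈ y → x ≉ 0# → x ÷ y ≈ 1#
  x≈y⇒x÷y≈1 {x} {y} x≈y x≉0 = trans (*-congˡ (⁻¹-cong (sym x≈y))) (⁻¹-inverse x x≉0)

  pow-+ : ∀ a m n → pow a (m +ℕ n) ≈ pow a m * pow a n
  pow-+ a zero    n = sym (*-identityˡ _)
  pow-+ a (suc m) n = trans (*-congˡ (pow-+ a m n)) (sym (*-assoc _ _ _))

  pow-+1 : ∀ a m → pow a (m +ℕ 1) ≈ a * pow a m
  pow-+1 a m = reflexive (cong (pow a) (ℕ.+-comm m 1))

  poch-cong : ∀ {a b} q m → a ≈ b → poch a q m ≈ poch b q m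
  poch-cong q zero    a≈b = refl
  poch-cong q (suc m) a≈b = *-cong (poch-cong q m a≈b) (+-congˡ (-‿cong (*-congʳ a≈b)))

  poch-sucˡ : ∀ a q m → poch a q (suc m) ≈ (1# - a) * poch (a * q) q m
  poch-sucˡ a q zero    = solve 1 (λ a → :1 :* (:1 :- a :* :1) := (:1 :- a) :* :1) refl a
  poch-sucˡ a q (suc m) = begin
    poch a q (suc m) * (1# - a * (q * pow q m))
      ≈⟨ *-congʳ (poch-sucˡ a q m) ⟩
    (1# - a) * poch (a * q) q m * (1# - a * (q * pow q m))
      ≈⟨ solve 4 (λ a q P Q → (:1 :- a) :* P :* (:1 :- a :* (q :* Q)) := (:1 :- a) :* (P :* (:1 :- a :* q :* Q)))
               refl a q (poch (a * q) q m) (pow q m) ⟩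
    (1# - a) * (poch (a * q) q m * (1# - a * q * pow q m))
      ∎

  pow-2k+1 : ∀ a k → pow a (2 *ℕ k +ℕ 1) ≈ a * (pow a k * pow a k)
  pow-2k+1 a k = trans (reflexive (cong (pow a) (2k+1≡1+[k+k] k))) (*-congˡ (pow-+ a k k))

  pow-3k+2 : ∀ a k → pow a (3 *ℕ k +ℕ 2) ≈ a * (a * (pow a k * (pow a k * pow a k)))
  pow-3k+2 a k = trans (reflexive (cong (pow a) (3k+2≡2+[k+[k+k]] k)))
                       (*-congˡ (*-congˡ (trans (pow-+ a k (k +ℕ k)) (*-congˡ (pow-+ a k k)))))

  sumTo-telescope : ∀ m (f g h : ℕ → Carrier) → (∀ k → k ≤ m → f k + h k ≈ g k + h (suc k)) →
                    sumTo m f + h 0 ≈ sumTo m g + h (suc m)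
  sumTo-telescope zero    f g h step = step 0 z≤n
  sumTo-telescope (suc m) f g h step = begin
    sumTo m f + f (suc m) + h 0             ≈⟨ xy∙z≈xz∙y _ _ _ ⟩
    sumTo m f + h 0 + f (suc m)             ≈⟨ +-congʳ (sumTo-telescope m f g h (λ k k≤m → step k (m≤n⇒m≤1+n k≤m))) ⟩
    sumTo m g + h (suc m) + f (suc m)       ≈⟨ xy∙z≈x∙zy _ _ _ ⟩
    sumTo m g + (f (suc m) + h (suc m))     ≈⟨ +-congˡ (step (suc m) ≤-refl) ⟩
    sumTo m g + (g (suc m) + h (suc (suc m))) ≈⟨ +-assoc _ _ _ ⟨
    sumTo m g + g (suc m) + h (suc (suc m)) ∎

  module _ (q : Carrier) where

    qbinomBelow : ℕ → ℕ → Carrier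
    qbinomBelow n zero    = 0#
    qbinomBelow n (suc k) = qbinom q n k

    qbinom-diag : ∀ n → poch q q n ≉ 0# → qbinom q n n ≈ 1#
    qbinom-diag n P≉0 = x≈y⇒x÷y≈1 (trans (sym (*-identityʳ _)) (*-congˡ (reflexive (cong (poch q q) (≡.sym (n∸n≡0 n)))))) P≉0

    qbinom-zero : ∀ n → poch q q n ≉ 0# → qbinom q n 0 ≈ 1#
    qbinom-zero n P≉0 = x≈y⇒x÷y≈1 (sym (*-identityˡ _)) P≉0

    qbinom-by-multiple : ∀ n k {m r d} → n ∸ k ≡ m → poch q q k * poch q q m * r ≈ d → d ≉ 0# →
                         qbinom q n k ≈ poch q q n * (r * d ⁻¹)
    qbinom-by-multiple n k n∸k≡m PPr≈d d≉0 =
      *-congˡ (trans (⁻¹-cong (*-congˡ (reflexive (cong (poch q q) n∸k≡m)))) (x*y≈z⇒x⁻¹≈y*z⁻¹ PPr≈d d≉0))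

    module _ (j s : ℕ) (P₁₊ⱼ≉0 : poch q q (suc j) ≉ 0#) (P₁₊ₛ≉0 : poch q q (suc s) ≉ 0#) where
      private
        n = suc j +ℕ s
        d = poch q q (suc j) * poch q q (suc s)
        d≉0 = x≉0⇒y≉0⇒x*y≉0 P₁₊ⱼ≉0 P₁₊ₛ≉0

        [n,1+j] : qbinom q n (suc j) ≈ poch q q n * ((1# - q * pow q s) * d ⁻¹)
        [n,1+j] = qbinom-by-multiple n (suc j) (m+n∸m≡n j s) (*-assoc _ _ _) d≉0

        [n,j] : qbinom q n j ≈ poch q q n * ((1# - q * pow q j) * d ⁻¹)
        [n,j] = qbinom-by-multiple n j (1+j+s∸j≡1+s j s) (xy*z≈xz*y _ _ _) d≉0

      qbinom-pascal-suc : qbinom q (suc n) (suc j) ≈ qbinom q n (suc j) + pow q (suc s) * qbinom q n j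
      qbinom-pascal-suc = begin
        qbinom q (suc n) (suc j)
          ≈⟨ qbinom-by-multiple (suc n) (suc j) (1+j+s∸j≡1+s j s) (*-identityʳ _) d≉0 ⟩
        poch q q n * (1# - q * (q * pow q (j +ℕ s))) * (1# * d ⁻¹)
          ≈⟨ *-congʳ (*-congˡ (+-congˡ (-‿cong (*-congˡ (*-congˡ (pow-+ q j s)))))) ⟩
        poch q q n * (1# - q * (q * (pow q j * pow q s))) * (1# * d ⁻¹)
          ≈⟨ solve 5 (λ P q Qⱼ Qₛ d⁻¹ →
               P :* (:1 :- q :* (q :* (Qⱼ :* Qₛ))) :* (:1 :* d⁻¹)
                 := P :* ((:1 :- q :* Qₛ) :* d⁻¹) :+ q :* Qₛ :* (P :* ((:1 :- q :* Qⱼ) :* d⁻¹)))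
               refl (poch q q n) q (pow q j) (pow q s) (d ⁻¹) ⟩
        poch q q n * ((1# - q * pow q s) * d ⁻¹) + q * pow q s * (poch q q n * ((1# - q * pow q j) * d ⁻¹))
          ≈⟨ +-cong [n,1+j] (*-congˡ [n,j]) ⟨
        qbinom q n (suc j) + pow q (suc s) * qbinom q n j
          ∎

      qbinom-ratio-suc : qbinom q n (suc j) * (1# - pow q (suc j)) ≈ qbinom q n j * (1# - pow q (suc s))
      qbinom-ratio-suc = begin
        qbinom q n (suc j) * (1# - q * pow q j)
          ≈⟨ *-congʳ [n,1+j] ⟩
        poch q q n * ((1# - q * pow q s) * d ⁻¹) * (1# - q * pow q j)
          ≈⟨ solve 4 (λ P u v d⁻¹ → P :* (v :* d⁻¹) :* u := P :* (u :* d⁻¹) :* v)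
               refl (poch q q n) (1# - q * pow q j) (1# - q * pow q s) (d ⁻¹) ⟩
        poch q q n * ((1# - q * pow q j) * d ⁻¹) * (1# - q * pow q s)
          ≈⟨ *-congʳ [n,j] ⟨
        qbinom q n j * (1# - q * pow q s)
          ∎

    qbinom-pascal : ∀ k s → NonzeroUpTo (poch q q) (suc (k +ℕ s)) →
                    qbinom q (suc (k +ℕ s)) k ≈ qbinom q (k +ℕ s) k + pow q (suc s) * qbinomBelow (k +ℕ s) k
    qbinom-pascal zero    s P≉0 = begin
      qbinom q (suc s) 0                   ≈⟨ qbinom-zero (suc s) (P≉0 (suc s) ≤-refl) ⟩
      1#                                   ≈⟨ qbinom-zero s (P≉0 s (n≤1+n s)) ⟨
      qbinom q s 0                         ≈⟨ +-identityʳ _ ⟨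
      qbinom q s 0 + 0#                    ≈⟨ +-congˡ (zeroʳ _) ⟨
      qbinom q s 0 + pow q (suc s) * 0#    ∎
    qbinom-pascal (suc j) s P≉0 =
      qbinom-pascal-suc j s (P≉0 (suc j) (s≤s (m≤n⇒m≤1+n (m≤m+n j s)))) (P≉0 (suc s) (s≤s (m≤n⇒m≤1+n (m≤n+m s j))))

    qbinom-ratio : ∀ k s → NonzeroUpTo (poch q q) (k +ℕ s) →
                   qbinom q (k +ℕ s) k * (1# - pow q k) ≈ qbinomBelow (k +ℕ s) k * (1# - pow q (suc s))
    qbinom-ratio zero    s P≉0 = begin
      qbinom q s 0 * (1# - 1#)       ≈⟨ *-congˡ (-‿inverseʳ 1#) ⟩
      qbinom q s 0 * 0#              ≈⟨ zeroʳ _ ⟩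
      0#                             ≈⟨ zeroˡ _ ⟨
      0# * (1# - pow q (suc s))      ∎
    qbinom-ratio (suc j) s P≉0 =
      qbinom-ratio-suc j s (P≉0 (suc j) (s≤s (m≤m+n j s))) (P≉0 (suc s) (s≤s (m≤n+m s j)))

  module _ (q x : Carrier) where

    weight : ℕ → Carrier
    weight k = pow (- 1#) k * pow x k * pow q (pentagonal k)

    denom : ℕ → ℕ → Carrier
    denom n k = poch (x * pow q (k +ℕ 1)) q (n +ℕ 1)

    summand : ℕ → ℕ → Carrier → Carrier
    summand n k β = weight k * β * ((1# - x * pow q (2 *ℕ k +ℕ 1)) ÷ denom n k)

    certificate : ℕ → ℕ → Carrier → Carrier
    certificate n k β = - (weight k * pow q (suc n ∸ k) * β * denom n k ⁻¹)

    certificate-0 : ∀ n k → certificate n k 0# ≈ 0#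
    certificate-0 n k = trans (-‿cong (trans (*-congʳ (zeroʳ _)) (zeroˡ _))) -0#≈0#

    weight-suc : ∀ k → weight (suc k) ≈ - (weight k * (x * pow q (3 *ℕ k +ℕ 2)))
    weight-suc k = begin
      - 1# * pow (- 1#) k * (x * pow x k) * pow q (pentagonal (suc k))
        ≈⟨ *-congˡ (trans (reflexive (cong (pow q) (pentagonal-suc k))) (pow-+ q (pentagonal k) (3 *ℕ k +ℕ 2))) ⟩
      - 1# * pow (- 1#) k * (x * pow x k) * (pow q (pentagonal k) * pow q (3 *ℕ k +ℕ 2))
        ≈⟨ solve 5 (λ σ X P x Q → :- :1 :* σ :* (x :* X) :* (P :* Q) := :- (σ :* X :* P :* (x :* Q)))
             refl (pow (- 1#) k) (pow x k) (pow q (pentagonal k)) x (pow q (3 *ℕ k +ℕ 2)) ⟩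
      - (weight k * (x * pow q (3 *ℕ k +ℕ 2)))
        ∎

    denom-suc : ∀ n k → denom (suc n) k ≈ (1# - x * pow q (k +ℕ 1)) * denom n (suc k)
    denom-suc n k = trans (poch-sucˡ (x * pow q (k +ℕ 1)) q (n +ℕ 1))
      (*-congˡ (poch-cong q (n +ℕ 1) (xy*z≈x*zy x _ q)))

    module _ (n k : ℕ) (D≉0 : denom (suc n) k ≉ 0#) where

      denom⁻¹-lengthen : denom n k ⁻¹ ≈ (1# - x * pow q (k +ℕ 1) * pow q (n +ℕ 1)) * denom (suc n) k ⁻¹
      denom⁻¹-lengthen = x*y≈z⇒x⁻¹≈y*z⁻¹ refl D≉0

      denom⁻¹-shift : denom n (suc k) ⁻¹ ≈ (1# - x * pow q (k +ℕ 1)) * denom (suc n) k ⁻¹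
      denom⁻¹-shift = x*y≈z⇒x⁻¹≈y*z⁻¹ (trans (*-comm _ _) (sym (denom-suc n k))) D≉0

    wz-step : ∀ k s {β⁺ β β⁻} → denom (suc (k +ℕ s)) k ≉ 0# →
              β⁺ ≈ β + pow q (suc s) * β⁻ → β * (1# - pow q k) ≈ β⁻ * (1# - pow q (suc s)) →
              summand (suc (k +ℕ s)) k β⁺ + certificate (k +ℕ s) k β⁻
                ≈ summand (k +ℕ s) k β + certificate (k +ℕ s) (suc k) β
    wz-step k s {β⁺} {β} {β⁻} D≉0 pascal ratio = begin
      summand (suc n) k β⁺ + certificate n k β⁻
        ≈⟨ +-cong (*-cong (*-congˡ pascal) (*-congʳ numerator))
                  (-‿cong (*-cong (*-congʳ (*-congˡ (reflexive (cong (pow q) (1+j+s∸j≡1+s k s))))) denom-n-k⁻¹)) ⟩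
      w * (β + q * B * β⁻) * ((1# - x * (q * (A * A))) * I)
        - w * (q * B) * β⁻ * ((1# - x * (q * A) * (q * (A * B))) * I)
        -- the two sides differ by a multiple of the ratio hypothesis
        ≈⟨ solve 8 (λ w x q A B β β⁻ I →
             w :* (β :+ q :* B :* β⁻) :* ((:1 :- x :* (q :* (A :* A))) :* I)
               :- w :* (q :* B) :* β⁻ :* ((:1 :- x :* (q :* A) :* (q :* (A :* B))) :* I)
             := w :* β :* ((:1 :- x :* (q :* (A :* A))) :* ((:1 :- x :* (q :* A) :* (q :* (A :* B))) :* I))
                  :- :- (w :* (x :* (q :* (q :* (A :* (A :* A)))))) :* B :* β :* ((:1 :- x :* (q :* A)) :* I)
                :+ w :* x :* q :* q :* A :* A :* B :* I :* (β :* (:1 :- A) :- β⁻ :* (:1 :- q :* B)))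
             refl w x q A B β β⁻ I ⟩
      summand′ - weight′ * B * β * ((1# - x * (q * A)) * I) + w * x * q * q * A * A * B * I * (β * (1# - A) - β⁻ * (1# - q * B))
        ≈⟨ +-congˡ (trans (*-congˡ (trans (+-congʳ ratio) (-‿inverseʳ _))) (zeroʳ _)) ⟩
      summand′ - weight′ * B * β * ((1# - x * (q * A)) * I) + 0#
        ≈⟨ +-identityʳ _ ⟩
      summand′ - weight′ * B * β * ((1# - x * (q * A)) * I)
        ≈⟨ +-cong (*-congˡ (*-cong numerator denom-n-k⁻¹))
                  (-‿cong (*-cong (*-congʳ (*-cong weight-suc-k (reflexive (cong (pow q) (m+n∸m≡n k s))))) denom-n-1+k⁻¹)) ⟨
      summand n k β + certificate n (suc k) β
        ∎
      where
      n = k +ℕ s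
      A = pow q k
      B = pow q s
      w = weight k
      I = denom (suc n) k ⁻¹
      summand′ = w * β * ((1# - x * (q * (A * A))) * ((1# - x * (q * A) * (q * (A * B))) * I))
      weight′ = - (w * (x * (q * (q * (A * (A * A))))))

      numerator : 1# - x * pow q (2 *ℕ k +ℕ 1) ≈ 1# - x * (q * (A * A))
      numerator = +-congˡ (-‿cong (*-congˡ (pow-2k+1 q k)))

      weight-suc-k : weight (suc k) ≈ weight′
      weight-suc-k = trans (weight-suc k) (-‿cong (*-congˡ (*-congˡ (pow-3k+2 q k))))

      denom-n-k⁻¹ : denom n k ⁻¹ ≈ (1# - x * (q * A) * (q * (A * B))) * I
      denom-n-k⁻¹ = trans (denom⁻¹-lengthen n k D≉0)
        (*-congʳ (+-congˡ (-‿cong (*-cong (*-congˡ (pow-+1 q k)) (trans (pow-+1 q n) (*-congˡ (pow-+ q k s)))))))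

      denom-n-1+k⁻¹ : denom n (suc k) ⁻¹ ≈ (1# - x * (q * A)) * I
      denom-n-1+k⁻¹ = trans (denom⁻¹-shift n k D≉0) (*-congʳ (+-congˡ (-‿cong (*-congˡ (pow-+1 q k)))))

    summand-diagonal : ∀ n {β} → denom (suc n) (suc n) ≉ 0# →
                       summand (suc n) (suc n) β + certificate n (suc n) β ≈ 0#
    summand-diagonal n {β} D≉0 = begin
      summand (suc n) (suc n) β + certificate n (suc n) β
        ≈⟨ +-cong (*-congˡ (*-congʳ numerator))
                  (-‿cong (*-cong (*-congʳ (*-congˡ (reflexive (cong (pow q) (n∸n≡0 n))))) denom-n-k⁻¹)) ⟩
      w * β * ((1# - x * (q * (A * A))) * I) - w * 1# * β * ((1# - x * (q * A) * A) * I)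
        ≈⟨ solve 6 (λ w β′ x q A I →
             w :* β′ :* ((:1 :- x :* (q :* (A :* A))) :* I) :- w :* :1 :* β′ :* ((:1 :- x :* (q :* A) :* A) :* I)
             := w :* β′ :* ((:1 :- x :* (q :* (A :* A))) :* I) :- w :* β′ :* ((:1 :- x :* (q :* (A :* A))) :* I))
             refl w β x q A I ⟩
      w * β * ((1# - x * (q * (A * A))) * I) - w * β * ((1# - x * (q * (A * A))) * I)
        ≈⟨ -‿inverseʳ _ ⟩
      0#
        ∎
      where
      A = pow q (suc n)
      w = weight (suc n)
      I = denom (suc n) (suc n) ⁻¹

      numerator : 1# - x * pow q (2 *ℕ suc n +ℕ 1) ≈ 1# - x * (q * (A * A))
      numerator = +-congˡ (-‿cong (*-congˡ (pow-2k+1 q (suc n))))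

      denom-n-k⁻¹ : denom n (suc n) ⁻¹ ≈ (1# - x * (q * A) * A) * I
      denom-n-k⁻¹ = trans (denom⁻¹-lengthen n (suc n) D≉0)
        (*-congʳ (+-congˡ (-‿cong (*-cong (*-congˡ (pow-+1 q (suc n))) (pow-+1 q n)))))

    summand-step : ∀ n k → k ≤ n → NonzeroUpTo (poch q q) (suc n) → NonzeroUpTo (denom (suc n)) (suc n) →
                   summand (suc n) k (qbinom q (suc n) k) + certificate n k (qbinomBelow q n k)
                     ≈ summand n k (qbinom q n k) + certificate n (suc k) (qbinomBelow q n (suc k))
    summand-step n k k≤n P≉0 D≉0 with m≤n⇒∃[o]m+o≡n k≤n
    ... | s , ≡.refl = wz-step k s (D≉0 k (m≤n⇒m≤1+n k≤n))
                         (qbinom-pascal q k s P≉0) (qbinom-ratio q k s (λ m m≤n → P≉0 m (m≤n⇒m≤1+n m≤n)))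

    sumTo-summand : ∀ n → NonzeroUpTo (poch q q) n → NonzeroUpTo (denom n) n →
                    sumTo n (λ k → summand n k (qbinom q n k)) ≈ 1#
    sumTo-summand zero P≉0 D≉0 = begin
      1# * 1# * 1# * qbinom q 0 0 * ((1# - x * (q * 1#)) ÷ denom 0 0)
        ≈⟨ *-cong (*-congˡ (qbinom-diag q 0 (P≉0 0 z≤n))) (x≈y⇒x÷y≈1 num≈D num≉0) ⟩
      1# * 1# * 1# * 1# * 1#
        ≈⟨ solve 0 (:1 :* :1 :* :1 :* :1 :* :1 := :1) refl ⟩
      1#
        ∎
      where
      num≈D : 1# - x * (q * 1#) ≈ denom 0 0
      num≈D = solve 2 (λ x q → :1 :- x :* (q :* :1) := :1 :* (:1 :- x :* (q :* :1) :* :1)) refl x q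
      num≉0 : 1# - x * (q * 1#) ≉ 0#
      num≉0 num≈0 = D≉0 0 z≤n (trans (sym num≈D) num≈0)
    sumTo-summand (suc n) P≉0 D≉0 = begin
      sumTo n f + f (suc n)                 ≈⟨ +-congʳ (+-identityʳ _) ⟨
      sumTo n f + 0# + f (suc n)            ≈⟨ +-congʳ (+-congˡ (certificate-0 n 0)) ⟨
      sumTo n f + h 0 + f (suc n)           ≈⟨ +-congʳ (sumTo-telescope n f g h (λ k k≤n → summand-step n k k≤n P≉0 D≉0)) ⟩
      sumTo n g + h (suc n) + f (suc n)     ≈⟨ xy∙z≈x∙zy _ _ _ ⟩
      sumTo n g + (f (suc n) + h (suc n))   ≈⟨ +-congˡ diagonal ⟩
      sumTo n g + 0#                        ≈⟨ +-identityʳ _ ⟩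
      sumTo n g                             ≈⟨ sumTo-summand n (λ m m≤n → P≉0 m (m≤n⇒m≤1+n m≤n))
                                                              (λ k k≤n → x*y≉0⇒x≉0 (D≉0 k (m≤n⇒m≤1+n k≤n))) ⟩
      1#                                    ∎
      where
      f g h : ℕ → Carrier
      f k = summand (suc n) k (qbinom q (suc n) k)
      g k = summand n k (qbinom q n k)
      h k = certificate n k (qbinomBelow q n k)

      [1+n,1+n]≈[n,n] : qbinom q (suc n) (suc n) ≈ qbinom q n n
      [1+n,1+n]≈[n,n] = trans (qbinom-diag q (suc n) (P≉0 (suc n) ≤-refl)) (sym (qbinom-diag q n (P≉0 n (n≤1+n n))))

      diagonal : f (suc n) + h (suc n) ≈ 0#
      diagonal = trans (+-congʳ (*-congʳ (*-congˡ [1+n,1+n]≈[n,n]))) (summand-diagonal n (D≉0 (suc n) ≤-refl))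

mainTheorem2 : ∀ {c ℓ} (F : Field c ℓ) → let open FieldOps F in
    (q x : Carrier) (n : ℕ) →
    (∀ m → m ≤ n → ¬ (poch q q m ≈ 0#)) →
    (∀ k → k ≤ n → ¬ (poch (x * pow q (k +ℕ 1)) q (n +ℕ 1) ≈ 0#)) →
    sumTo n (λ k →
      pow (- 1#) k * pow x k * pow q ((k *ℕ (3 *ℕ k +ℕ 1)) / 2) * qbinom q n k
        * ((1# - x * pow q (2 *ℕ k +ℕ 1)) ÷ poch (x * pow q (k +ℕ 1)) q (n +ℕ 1)))
      ≈ 1#
mainTheorem2 F = sumTo-summand F
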